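{- For every prime $p$ and integers $\nu_1,\nu_2\ge0$, \[\tilde\mu(p^{\nu_1},p^{\nu_2})=\begin{cases}1 & \text{if }\nu_1=\nu_2=0,\\ -1&\text{if }\nu_1+\nu_2=1,\\ 2-p&\text{if }\nu_1=\nu_2=1,\\ p-1&\text{if }|\nu_1-\nu_2|=1\text{ and }\nu_1,\nu_2\ge1,\\ 2-2p&\text{if }\nu_1=\nu_2\ge2,\\ 0&\text{otherwise.}\end{cases}\]
   Context: $\tilde\mu$ is the Dirichlet inverse of the function $(n_1,n_2)\mapsto\gcd(n_1,n_2)$ with respect to the two-variable Dirichlet convolution $(f*g)(n_1,n_2)=\sum_{d_1\mid n_1,\,d_2\mid n_2}f(d_1,d_2)g(n_1/d_1,n_2/d_2)$, i.e. $(\tilde\mu*\gcd)(n_1,n_2)=1$ if $n_1=n_2=1$ and $0$ otherwise. -}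

module Defs where

open import Data.Nat using (ℕ; zero; suc; _*_; _≟_; _≡ᵇ_; _≤ᵇ_; ∣_-_∣)
import Data.Nat as ℕ
open import Data.Nat.GCD using (gcd)
open import Data.Integer using (ℤ; +_; -_; 0ℤ; 1ℤ)
import Data.Integer as ℤ
open import Data.List using (List; filter; map; cartesianProduct; applyUpTo; foldr)
open import Data.Product using (_×_; _,_)
open import Data.Bool using (Bool; if_then_else_; _∧_)
open import Relation.Binary.PropositionalEquality using (_≡_)

-- arithmetic functions of two variables (only values at positive arguments matter)
ArithFun₂ : Set
ArithFun₂ = ℕ → ℕ → ℤ

divPairs : ℕ → List (ℕ × ℕ)
divPairs n = filter (λ { (d , e) → d * e ≟ n })
                    (cartesianProduct (applyUpTo suc n) (applyUpTo suc n))

sumℤ : List ℤ → ℤ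
sumℤ = foldr ℤ._+_ 0ℤ

_⋆_ : ArithFun₂ → ArithFun₂ → ArithFun₂
(f ⋆ g) n₁ n₂ =
  sumℤ (map (λ { ((d₁ , e₁) , (d₂ , e₂)) → f d₁ d₂ ℤ.* g e₁ e₂ })
            (cartesianProduct (divPairs n₁) (divPairs n₂)))

gcdFun : ArithFun₂
gcdFun n₁ n₂ = + gcd n₁ n₂

δ₂ : ArithFun₂
δ₂ n₁ n₂ = if (n₁ ≡ᵇ 1) ∧ (n₂ ≡ᵇ 1) then 1ℤ else 0ℤ

IsInverseOfGcd : ArithFun₂ → Set
IsInverseOfGcd f = ∀ n₁ n₂ → 1 ℕ.≤ n₁ → 1 ℕ.≤ n₂ → (f ⋆ gcdFun) n₁ n₂ ≡ δ₂ n₁ n₂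

μ̃-formula : ℕ → ℕ → ℕ → ℤ
μ̃-formula p ν₁ ν₂ =
  if (ν₁ ≡ᵇ 0) ∧ (ν₂ ≡ᵇ 0) then 1ℤ
  else if (ν₁ ℕ.+ ν₂) ≡ᵇ 1 then - 1ℤ
  else if (ν₁ ≡ᵇ 1) ∧ (ν₂ ≡ᵇ 1) then + 2 ℤ.- + p
  else if (∣ ν₁ - ν₂ ∣ ≡ᵇ 1) ∧ (1 ≤ᵇ ν₁) ∧ (1 ≤ᵇ ν₂) then + p ℤ.- 1ℤ
  else if (ν₁ ≡ᵇ ν₂) ∧ (2 ≤ᵇ ν₁) then + 2 ℤ.- + (2 * p)
  else 0ℤ

{-# OPTIONS --safe #-}
module Submission where

-- At prime powers the convolution with gcd becomes the two-dimensional Cauchy product ⊛ with the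
-- kernel k(x, y) = p^min(x,y), because the divisor pairs of p^n are the (p^i, p^(n−i)). This product is
-- triangular with k(0, 0) = 1, so the inverse of gcd is determined by its values at prime powers and it
-- suffices to check that μ̃-formula p ⊛ k is the unit δ₀. The formula is the coefficient array of
-- (1 − X)(1 − Y)(1 − pXY)/(1 − XY), so one step along the diagonal changes it only on {0,1}²; together
-- with k(x + 1, y + 1) = p · k(x, y) this gives the check by induction along the diagonal.

open import Defs
open import Data.Nat using (ℕ; _^_)
open import Data.Nat.Primality using (Prime)
open import Relation.Binary.PropositionalEquality using (_≡_)

open import Function using (_∘_)
open import Function.Bundles using (mk⇔)
open import Data.Bool using (false)
open import Data.Empty using (⊥-elim)
open import Data.Product using (∃; _×_; _,_; proj₁)
open import Data.Sum using (inj₁; inj₂)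
open import Relation.Nullary using (yes; no)
open import Relation.Binary.PropositionalEquality using (refl; sym; trans; cong; cong₂; subst; setoid)
open import Relation.Binary.PropositionalEquality.Properties using (module ≡-Reasoning)
open import Data.Nat using (zero; suc; _∸_; _⊓_; _<_; _≤_; _≡ᵇ_; s≤s; z≤n; NonZero)
import Data.Nat as ℕ
import Data.Nat.Properties as ℕ
open import Data.Nat.Induction using (<-rec)
open import Data.Nat.Divisibility using (_∣_; divides; _∣?_; ∣1⇒≡1; *-cancelʳ-∣)
open import Data.Nat.GCD using (gcd; gcd-zeroˡ; gcd-zeroʳ; c*gcd[m,n]≡gcd[cm,cn])
open import Data.Nat.Coprimality using (Coprime; coprime-divisor)
open import Data.Nat.Primality using (prime⇒irreducible; prime⇒nonZero; prime⇒nonTrivial)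
open import Data.Integer using (ℤ; +_; -_; 0ℤ; 1ℤ; _+_; _*_; _-_)
import Data.Integer as ℤ
import Data.Integer.Properties as ℤ
open import Data.Integer.Tactic.RingSolver using (solve-∀)
open import Algebra.Properties.CommutativeSemigroup ℤ.+-commutativeSemigroup
  using () renaming (interchange to +-interchange)
open import Algebra.Properties.AbelianGroup ℤ.+-0-abelianGroup
  using () renaming (∙-cancelˡ to +-cancelˡ)
open import Data.List using ([]; _∷_; _++_; map; cartesianProduct; applyUpTo)
import Data.List.Properties as List
open import Data.List.Membership.Propositional using (_∈_)
open import Data.List.Membership.Propositional.Properties
  using (∈-filter⁺; ∈-filter⁻; ∈-cartesianProduct⁺; ∈-applyUpTo⁺; ∈-applyUpTo⁻)
open import Data.List.Membership.Propositional.Properties.WithK using (unique∧set⇒bag)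
open import Data.List.Relation.Unary.Unique.Propositional using (Unique)
import Data.List.Relation.Unary.Unique.Propositional.Properties as Unique
open import Data.List.Relation.Binary.Permutation.Propositional using (_↭_; ↭⇒↭ₛ)
import Data.List.Relation.Binary.Permutation.Propositional.Properties as ↭
open import Data.List.Relation.Binary.Permutation.Setoid.Properties using (foldr-commMonoid)
open import Data.List.Relation.Binary.BagAndSetEquality using (∼bag⇒↭)

open ≡-Reasoning

∑ : ℕ → (ℕ → ℤ) → ℤ
∑ zero    f = 0ℤ
∑ (suc n) f = f 0 + ∑ n (f ∘ suc)

syntax ∑ n (λ i → e) = ∑[ i < n ] e

∑-cong : ∀ n {f g : ℕ → ℤ} → (∀ i → i < n → f i ≡ g i) → ∑ n f ≡ ∑ n g
∑-cong zero    f≡g = refl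
∑-cong (suc n) f≡g = cong₂ _+_ (f≡g 0 (s≤s z≤n)) (∑-cong n (λ i i<n → f≡g (suc i) (s≤s i<n)))

∑-zero : ∀ n → ∑[ i < n ] 0ℤ ≡ 0ℤ
∑-zero zero    = refl
∑-zero (suc n) = trans (ℤ.+-identityˡ (∑[ i < n ] 0ℤ)) (∑-zero n)

∑-head : ∀ n (f : ℕ → ℤ) → (∀ i → f (suc i) ≡ 0ℤ) → ∑ (suc n) f ≡ f 0
∑-head n f tail≡0 =
  trans (cong (_+_ (f 0)) (trans (∑-cong n (λ i _ → tail≡0 i)) (∑-zero n))) (ℤ.+-identityʳ (f 0))

∑-head₂ : ∀ n (f : ℕ → ℤ) → (∀ i → f (suc (suc i)) ≡ 0ℤ) → ∑ (suc (suc n)) f ≡ f 0 + f 1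
∑-head₂ n f tail≡0 = cong (_+_ (f 0)) (∑-head n (f ∘ suc) tail≡0)

∑-distrib-+ : ∀ n (f g : ℕ → ℤ) → ∑[ i < n ] (f i + g i) ≡ ∑ n f + ∑ n g
∑-distrib-+ zero    f g = refl
∑-distrib-+ (suc n) f g =
  trans (cong (_+_ (f 0 + g 0)) (∑-distrib-+ n (f ∘ suc) (g ∘ suc))) (+-interchange (f 0) (g 0) _ _)

∑-last : ∀ n (f : ℕ → ℤ) → ∑ (suc n) f ≡ ∑ n f + f n
∑-last zero    f = trans (ℤ.+-identityʳ (f 0)) (sym (ℤ.+-identityˡ (f 0)))
∑-last (suc n) f = trans (cong (_+_ (f 0)) (∑-last n (f ∘ suc))) (sym (ℤ.+-assoc (f 0) _ _))

_⊛_ : (ℕ → ℕ → ℤ) → (ℕ → ℕ → ℤ) → ℕ → ℕ → ℤ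
(w ⊛ k) a b = ∑[ i < suc a ] ∑[ j < suc b ] (w i j * k (a ∸ i) (b ∸ j))

⊛-cong : ∀ {u v k l : ℕ → ℕ → ℤ} → (∀ i j → u i j ≡ v i j) → (∀ x y → k x y ≡ l x y) →
         ∀ a b → (u ⊛ k) a b ≡ (v ⊛ l) a b
⊛-cong u≡v k≡l a b =
  ∑-cong (suc a) (λ i _ → ∑-cong (suc b) (λ j _ → cong₂ _*_ (u≡v i j) (k≡l (a ∸ i) (b ∸ j))))

⊛-distribʳ-+ : ∀ (u v k : ℕ → ℕ → ℤ) a b →
               ((λ i j → u i j + v i j) ⊛ k) a b ≡ (u ⊛ k) a b + (v ⊛ k) a b
⊛-distribʳ-+ u v k a b = begin
  ∑[ i < suc a ] ∑[ j < suc b ] ((u i j + v i j) * k (a ∸ i) (b ∸ j))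
    ≡⟨ ∑-cong (suc a) (λ i _ → ∑-cong (suc b) (λ j _ →
         ℤ.*-distribʳ-+ (k (a ∸ i) (b ∸ j)) (u i j) (v i j))) ⟩
  ∑[ i < suc a ] ∑[ j < suc b ] (u i j * k (a ∸ i) (b ∸ j) + v i j * k (a ∸ i) (b ∸ j))
    ≡⟨ ∑-cong (suc a) (λ i _ → ∑-distrib-+ (suc b) (λ j → u i j * k (a ∸ i) (b ∸ j))
                                                   (λ j → v i j * k (a ∸ i) (b ∸ j))) ⟩
  ∑[ i < suc a ] (∑[ j < suc b ] (u i j * k (a ∸ i) (b ∸ j)) + ∑[ j < suc b ] (v i j * k (a ∸ i) (b ∸ j)))
    ≡⟨ ∑-distrib-+ (suc a) (λ i → ∑[ j < suc b ] (u i j * k (a ∸ i) (b ∸ j)))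
                           (λ i → ∑[ j < suc b ] (v i j * k (a ∸ i) (b ∸ j))) ⟩
  (u ⊛ k) a b + (v ⊛ k) a b ∎

⊛-suc-suc : ∀ (w k : ℕ → ℕ → ℤ) a b → (w ⊛ k) (suc a) (suc b) ≡
            ∑[ j < suc (suc b) ] (w 0 j * k (suc a) (suc b ∸ j)) +
            (∑[ i < suc a ] (w (suc i) 0 * k (a ∸ i) (suc b)) + ((λ i j → w (suc i) (suc j)) ⊛ k) a b)
⊛-suc-suc w k a b = cong (_+_ (∑[ j < suc (suc b) ] (w 0 j * k (suc a) (suc b ∸ j))))
  (∑-distrib-+ (suc a) (λ i → w (suc i) 0 * k (a ∸ i) (suc b))
                       (λ i → ∑[ j < suc b ] (w (suc i) (suc j) * k (a ∸ i) (b ∸ j))))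

⊛-cancelʳ : ∀ (w w′ k : ℕ → ℕ → ℤ) .{{_ : ℤ.NonZero (k 0 0)}} →
            (∀ a b → (w ⊛ k) a b ≡ (w′ ⊛ k) a b) → ∀ a b → w a b ≡ w′ a b
⊛-cancelʳ w w′ k w⊛k≡w′⊛k =
  <-rec (λ a → ∀ b → w a b ≡ w′ a b) λ a earlier-rows →
  <-rec (λ b → w a b ≡ w′ a b)       λ b earlier-cols →
  ℤ.*-cancelʳ-≡ (w a b) (w′ a b) (k 0 0) (+-cancelˡ (earlier w a b) (w a b * k 0 0) (w′ a b * k 0 0) (begin
    earlier w a b + w a b * k 0 0    ≡⟨ split w a b ⟨
    (w ⊛ k) a b                      ≡⟨ w⊛k≡w′⊛k a b ⟩
    (w′ ⊛ k) a b                     ≡⟨ split w′ a b ⟩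
    earlier w′ a b + w′ a b * k 0 0  ≡⟨ cong (_+ w′ a b * k 0 0) (earlier-cong a b earlier-rows earlier-cols) ⟨
    earlier w a b + w′ a b * k 0 0   ∎))
  where
  row : (ℕ → ℕ → ℤ) → ℕ → ℕ → ℕ → ℤ
  row v a b i = ∑[ j < suc b ] (v i j * k (a ∸ i) (b ∸ j))

  earlier : (ℕ → ℕ → ℤ) → ℕ → ℕ → ℤ
  earlier v a b = ∑ a (row v a b) + ∑[ j < b ] (v a j * k (a ∸ a) (b ∸ j))

  split : ∀ v a b → (v ⊛ k) a b ≡ earlier v a b + v a b * k 0 0
  split v a b = begin
    ∑ (suc a) (row v a b)
      ≡⟨ ∑-last a (row v a b) ⟩
    ∑ a (row v a b) + row v a b a
      ≡⟨ cong (_+_ (∑ a (row v a b))) (∑-last b (λ j → v a j * k (a ∸ a) (b ∸ j))) ⟩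
    ∑ a (row v a b) + (∑[ j < b ] (v a j * k (a ∸ a) (b ∸ j)) + v a b * k (a ∸ a) (b ∸ b))
      ≡⟨ cong₂ (λ x y → ∑ a (row v a b) + (∑[ j < b ] (v a j * k (a ∸ a) (b ∸ j)) + v a b * k x y))
               (ℕ.n∸n≡0 a) (ℕ.n∸n≡0 b) ⟩
    ∑ a (row v a b) + (∑[ j < b ] (v a j * k (a ∸ a) (b ∸ j)) + v a b * k 0 0)
      ≡⟨ ℤ.+-assoc (∑ a (row v a b)) (∑[ j < b ] (v a j * k (a ∸ a) (b ∸ j))) (v a b * k 0 0) ⟨
    earlier v a b + v a b * k 0 0 ∎

  earlier-cong : ∀ a b → (∀ {i} → i < a → ∀ j → w i j ≡ w′ i j) → (∀ {j} → j < b → w a j ≡ w′ a j) →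
                 earlier w a b ≡ earlier w′ a b
  earlier-cong a b rows cols = cong₂ _+_
    (∑-cong a (λ i i<a → ∑-cong (suc b) (λ j _ → cong (_* k (a ∸ i) (b ∸ j)) (rows i<a j))))
    (∑-cong b (λ j j<b → cong (_* k (a ∸ a) (b ∸ j)) (cols j<b)))

⊛-zero-zero : ∀ (w k : ℕ → ℕ → ℤ) → (w ⊛ k) 0 0 ≡ w 0 0 * k 0 0
⊛-zero-zero w k = trans (ℤ.+-identityʳ (w 0 0 * k 0 0 + 0ℤ)) (ℤ.+-identityʳ (w 0 0 * k 0 0))

⊛-zero-suc : ∀ (w k : ℕ → ℕ → ℤ) b → (∀ j → w 0 (suc (suc j)) ≡ 0ℤ) →
             (w ⊛ k) 0 (suc b) ≡ w 0 0 * k 0 (suc b) + w 0 1 * k 0 b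
⊛-zero-suc w k b row₀ = trans (ℤ.+-identityʳ _)
  (∑-head₂ b (λ j → w 0 j * k 0 (suc b ∸ j)) (λ j → cong (_* k 0 (b ∸ suc j)) (row₀ j)))

⊛-suc-zero : ∀ (w k : ℕ → ℕ → ℤ) a → (∀ i → w (suc (suc i)) 0 ≡ 0ℤ) →
             (w ⊛ k) (suc a) 0 ≡ w 0 0 * k (suc a) 0 + w 1 0 * k a 0
⊛-suc-zero w k a col₀ =
  trans (∑-cong (suc (suc a)) (λ i _ → ℤ.+-identityʳ (w i 0 * k (suc a ∸ i) 0)))
  (∑-head₂ a (λ i → w i 0 * k (suc a ∸ i) 0) (λ i → cong (_* k (a ∸ suc i) 0) (col₀ i)))

⊛-suc-suc-sparse : ∀ (w k : ℕ → ℕ → ℤ) a b →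
                   (∀ j → w 0 (suc (suc j)) ≡ 0ℤ) → (∀ i → w (suc (suc i)) 0 ≡ 0ℤ) →
                   (w ⊛ k) (suc a) (suc b) ≡
                   (w 0 0 * k (suc a) (suc b) + w 0 1 * k (suc a) b) +
                   (w 1 0 * k a (suc b) + ((λ i j → w (suc i) (suc j)) ⊛ k) a b)
⊛-suc-suc-sparse w k a b row₀ col₀ = trans (⊛-suc-suc w k a b) (cong₂ _+_
  (∑-head₂ b (λ j → w 0 j * k (suc a) (suc b ∸ j)) (λ j → cong (_* k (suc a) (b ∸ suc j)) (row₀ j)))
  (cong (_+ ((λ i j → w (suc i) (suc j)) ⊛ k) a b)
    (∑-head a (λ i → w (suc i) 0 * k (a ∸ i) (suc b)) (λ i → cong (_* k (a ∸ suc i) (suc b)) (col₀ i)))))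

⊛-atOrigin : ∀ (w k : ℕ → ℕ → ℤ) a b → (∀ i j → w (suc i) j ≡ 0ℤ) → (∀ j → w 0 (suc j) ≡ 0ℤ) →
           (w ⊛ k) a b ≡ w 0 0 * k a b
⊛-atOrigin w k a b rows≡0 row₀ = begin
  ∑[ i < suc a ] ∑[ j < suc b ] (w i j * k (a ∸ i) (b ∸ j))
    ≡⟨ ∑-head a (λ i → ∑[ j < suc b ] (w i j * k (a ∸ i) (b ∸ j))) (λ i →
         trans (∑-cong (suc b) (λ j _ → cong (_* k (a ∸ suc i) (b ∸ j)) (rows≡0 i j))) (∑-zero (suc b))) ⟩
  ∑[ j < suc b ] (w 0 j * k (a ∸ 0) (b ∸ j))
    ≡⟨ ∑-head b (λ j → w 0 j * k a (b ∸ j)) (λ j → cong (_* k a (b ∸ suc j)) (row₀ j)) ⟩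
  w 0 0 * k a b ∎

sumℤ-++ : ∀ xs ys → sumℤ (xs ++ ys) ≡ sumℤ xs + sumℤ ys
sumℤ-++ []       ys = sym (ℤ.+-identityˡ (sumℤ ys))
sumℤ-++ (x ∷ xs) ys = trans (cong (_+_ x) (sumℤ-++ xs ys)) (sym (ℤ.+-assoc x (sumℤ xs) (sumℤ ys)))

sumℤ-↭ : ∀ {xs ys} → xs ↭ ys → sumℤ xs ≡ sumℤ ys
sumℤ-↭ xs↭ys = foldr-commMonoid (setoid ℤ) ℤ.+-0-isCommutativeMonoid (↭⇒↭ₛ xs↭ys)

sumℤ-applyUpTo : ∀ (f : ℕ → ℤ) n → sumℤ (applyUpTo f n) ≡ ∑ n f
sumℤ-applyUpTo f zero    = refl
sumℤ-applyUpTo f (suc n) = cong (_+_ (f 0)) (sumℤ-applyUpTo (f ∘ suc) n)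

sumℤ-cartesianProduct : ∀ {A B : Set} (f : A × B → ℤ) xs ys →
  sumℤ (map f (cartesianProduct xs ys)) ≡ sumℤ (map (λ x → sumℤ (map (λ y → f (x , y)) ys)) xs)
sumℤ-cartesianProduct f []       ys = refl
sumℤ-cartesianProduct f (x ∷ xs) ys = begin
  sumℤ (map f (map (x ,_) ys ++ cartesianProduct xs ys))
    ≡⟨ cong sumℤ (List.map-++ f (map (x ,_) ys) (cartesianProduct xs ys)) ⟩
  sumℤ (map f (map (x ,_) ys) ++ map f (cartesianProduct xs ys))
    ≡⟨ sumℤ-++ (map f (map (x ,_) ys)) _ ⟩
  sumℤ (map f (map (x ,_) ys)) + sumℤ (map f (cartesianProduct xs ys))
    ≡⟨ cong₂ _+_ (cong sumℤ (sym (List.map-∘ ys))) (sumℤ-cartesianProduct f xs ys) ⟩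
  sumℤ (map (λ y → f (x , y)) ys) + sumℤ (map (λ x → sumℤ (map (λ y → f (x , y)) ys)) xs) ∎

∣p^n⇒≡p^i : ∀ {p d} → Prime p → ∀ n → d ∣ p ^ n → ∃ λ i → i ≤ n × d ≡ p ^ i
∣p^n⇒≡p^i pr zero    d∣1 = 0 , z≤n , ∣1⇒≡1 d∣1
∣p^n⇒≡p^i {p} {d} pr (suc n) d∣p^[1+n] with p ∣? d
... | yes (divides q refl) =
  let q∣p^n = *-cancelʳ-∣ p (subst (q ℕ.* p ∣_) (ℕ.*-comm p (p ^ n)) d∣p^[1+n])
      i , i≤n , q≡p^i = ∣p^n⇒≡p^i {d = q} pr n q∣p^n
  in suc i , s≤s i≤n , trans (cong (ℕ._* p) q≡p^i) (ℕ.*-comm (p ^ i) p)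
  where instance _ = prime⇒nonZero pr
... | no p∤d =
  let i , i≤n , d≡p^i = ∣p^n⇒≡p^i pr n (coprime-divisor d⊥p d∣p^[1+n])
  in i , ℕ.m≤n⇒m≤1+n i≤n , d≡p^i
  where
  d⊥p : Coprime d p
  d⊥p (c∣d , c∣p) with prime⇒irreducible pr c∣p
  ... | inj₁ c≡1  = c≡1
  ... | inj₂ refl = ⊥-elim (p∤d c∣d)

∈-applyUpTo-suc : ∀ {x m} → 0 < x → x ≤ m → x ∈ applyUpTo suc m
∈-applyUpTo-suc {suc y} _ y<m = ∈-applyUpTo⁺ suc y<m

applyUpTo-suc-unique : ∀ m → Unique (applyUpTo suc m)
applyUpTo-suc-unique m = Unique.applyUpTo⁺₁ suc m (λ i<j _ → ℕ.<⇒≢ i<j ∘ ℕ.suc-injective)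

atPowers : ℕ → ArithFun₂ → ℕ → ℕ → ℤ
atPowers p f i j = f (p ^ i) (p ^ j)

module _ {p} (pr : Prime p) where

  private instance
    p≢0 : NonZero p
    p≢0 = prime⇒nonZero pr

  1<p : 1 < p
  1<p = ℕ.nonTrivial⇒n>1 p {{prime⇒nonTrivial pr}}

  complementaryPowers : ℕ → ℕ → ℕ × ℕ
  complementaryPowers n i = p ^ i , p ^ (n ∸ i)

  p^n≡p^i*p^[n∸i] : ∀ {n i} → i ≤ n → p ^ n ≡ p ^ i ℕ.* p ^ (n ∸ i)
  p^n≡p^i*p^[n∸i] {n} {i} i≤n =
    trans (cong (p ^_) (sym (ℕ.m+[n∸m]≡n i≤n))) (ℕ.^-distribˡ-+-* p i (n ∸ i))

  divPairs-^ : ∀ n → divPairs (p ^ n) ↭ applyUpTo (complementaryPowers n) (suc n)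
  divPairs-^ n = ∼bag⇒↭ (unique∧set⇒bag
    (Unique.filter⁺ _ (Unique.cartesianProduct⁺ (applyUpTo-suc-unique (p ^ n))
                                                (applyUpTo-suc-unique (p ^ n))))
    (Unique.applyUpTo⁺₁ (complementaryPowers n) (suc n)
      (λ i<j _ eq → ℕ.<⇒≢ (ℕ.^-monoʳ-< p 1<p i<j) (cong proj₁ eq)))
    (mk⇔ to from))
    where
    to : ∀ {z} → z ∈ divPairs (p ^ n) → z ∈ applyUpTo (complementaryPowers n) (suc n)
    to {d , e} z∈
      with ∈-filter⁻ _ {xs = cartesianProduct (applyUpTo suc (p ^ n)) (applyUpTo suc (p ^ n))} z∈
    ... | _ , de≡p^n with ∣p^n⇒≡p^i pr n (divides e (trans (sym de≡p^n) (ℕ.*-comm d e)))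
    ... | i , i≤n , refl =
      subst (_∈ applyUpTo (complementaryPowers n) (suc n)) (cong (p ^ i ,_) (sym e≡))
            (∈-applyUpTo⁺ (complementaryPowers n) (s≤s i≤n))
      where
      e≡ : e ≡ p ^ (n ∸ i)
      e≡ = ℕ.*-cancelˡ-≡ e _ (p ^ i) {{ℕ.m^n≢0 p i}} (trans de≡p^n (p^n≡p^i*p^[n∸i] i≤n))
    from : ∀ {z} → z ∈ applyUpTo (complementaryPowers n) (suc n) → z ∈ divPairs (p ^ n)
    from z∈ with ∈-applyUpTo⁻ (complementaryPowers n) z∈
    ... | i , s≤s i≤n , refl = ∈-filter⁺ _
      (∈-cartesianProduct⁺ (∈-applyUpTo-suc (ℕ.m^n>0 p i) (ℕ.^-monoʳ-≤ p i≤n))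
                           (∈-applyUpTo-suc (ℕ.m^n>0 p (n ∸ i)) (ℕ.^-monoʳ-≤ p (ℕ.m∸n≤m n i))))
      (sym (p^n≡p^i*p^[n∸i] i≤n))

  sumℤ-divPairs-^ : ∀ n (f : ℕ × ℕ → ℤ) →
                    sumℤ (map f (divPairs (p ^ n))) ≡ ∑[ i < suc n ] f (complementaryPowers n i)
  sumℤ-divPairs-^ n f = begin
    sumℤ (map f (divPairs (p ^ n)))
      ≡⟨ sumℤ-↭ (↭.map⁺ f (divPairs-^ n)) ⟩
    sumℤ (map f (applyUpTo (complementaryPowers n) (suc n)))
      ≡⟨ cong sumℤ (List.map-applyUpTo (complementaryPowers n) f (suc n)) ⟩
    sumℤ (applyUpTo (f ∘ complementaryPowers n) (suc n))
      ≡⟨ sumℤ-applyUpTo (f ∘ complementaryPowers n) (suc n) ⟩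
    ∑[ i < suc n ] f (complementaryPowers n i) ∎

  ⋆-atPowers : ∀ (F G : ArithFun₂) a b →
               (F ⋆ G) (p ^ a) (p ^ b) ≡ (atPowers p F ⊛ atPowers p G) a b
  ⋆-atPowers F G a b = begin
    sumℤ (map term (cartesianProduct (divPairs (p ^ a)) (divPairs (p ^ b))))
      ≡⟨ sumℤ-cartesianProduct term (divPairs (p ^ a)) (divPairs (p ^ b)) ⟩
    sumℤ (map (λ x → sumℤ (map (λ y → term (x , y)) (divPairs (p ^ b)))) (divPairs (p ^ a)))
      ≡⟨ sumℤ-divPairs-^ a (λ x → sumℤ (map (λ y → term (x , y)) (divPairs (p ^ b)))) ⟩
    ∑[ i < suc a ] sumℤ (map (λ y → term (complementaryPowers a i , y)) (divPairs (p ^ b)))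
      ≡⟨ ∑-cong (suc a) (λ i _ → sumℤ-divPairs-^ b (λ y → term (complementaryPowers a i , y))) ⟩
    (atPowers p F ⊛ atPowers p G) a b ∎
    where
    term : (ℕ × ℕ) × (ℕ × ℕ) → ℤ
    term ((d₁ , e₁) , (d₂ , e₂)) = F d₁ d₂ * G e₁ e₂

-- Uses ℤ's _^_ so that minPower p (suc x) (suc y) unfolds to + p * minPower p x y.
minPower : ℕ → ℕ → ℕ → ℤ
minPower p x y = (+ p) ℤ.^ (x ⊓ y)

gcd[p^m,p^n]≡p^[m⊓n] : ∀ p m n → gcd (p ^ m) (p ^ n) ≡ p ^ (m ⊓ n)
gcd[p^m,p^n]≡p^[m⊓n] p zero    n       = gcd-zeroˡ (p ^ n)
gcd[p^m,p^n]≡p^[m⊓n] p (suc m) zero    = gcd-zeroʳ (p ^ suc m)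
gcd[p^m,p^n]≡p^[m⊓n] p (suc m) (suc n) =
  trans (sym (c*gcd[m,n]≡gcd[cm,cn] p (p ^ m) (p ^ n))) (cong (p ℕ.*_) (gcd[p^m,p^n]≡p^[m⊓n] p m n))

pos-^ : ∀ m n → + (m ^ n) ≡ (+ m) ℤ.^ n
pos-^ m zero    = refl
pos-^ m (suc n) = trans (ℤ.pos-* m (m ^ n)) (cong (+ m *_) (pos-^ m n))

atPowers-gcdFun : ∀ p x y → atPowers p gcdFun x y ≡ minPower p x y
atPowers-gcdFun p x y = trans (cong +_ (gcd[p^m,p^n]≡p^[m⊓n] p x y)) (pos-^ p (x ⊓ y))

δ₀ : ℕ → ℕ → ℤ
δ₀ zero    zero    = 1ℤ
δ₀ zero    (suc _) = 0ℤ
δ₀ (suc _) _       = 0ℤ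

[p^[1+k]≡ᵇ1]≡false : ∀ {p} → 1 < p → ∀ k → (p ^ suc k ≡ᵇ 1) ≡ false
[p^[1+k]≡ᵇ1]≡false {p} 1<p k = [n≡ᵇ1]≡false (ℕ.^-monoʳ-< p 1<p {0} {suc k} (s≤s z≤n))
  where
  [n≡ᵇ1]≡false : ∀ {n} → 1 < n → (n ≡ᵇ 1) ≡ false
  [n≡ᵇ1]≡false {suc zero}    (s≤s ())
  [n≡ᵇ1]≡false {suc (suc _)} _ = refl

δ₂-^ : ∀ {p} → 1 < p → ∀ a b → δ₂ (p ^ a) (p ^ b) ≡ δ₀ a b
δ₂-^ 1<p zero    zero    = refl
δ₂-^ 1<p zero    (suc b) rewrite [p^[1+k]≡ᵇ1]≡false 1<p b = refl
δ₂-^ 1<p (suc a) b       rewrite [p^[1+k]≡ᵇ1]≡false 1<p a = refl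

module _ (p : ℕ) where

  private
    P : ℤ
    P = + p

  μ̃-increment : ℕ → ℕ → ℤ
  μ̃-increment 0             0             = 1ℤ - P
  μ̃-increment 0             1             = P
  μ̃-increment 0             (suc (suc j)) = 0ℤ
  μ̃-increment 1             0             = P
  μ̃-increment 1             1             = - P
  μ̃-increment 1             (suc (suc j)) = 0ℤ
  μ̃-increment (suc (suc i)) j             = 0ℤ

  μ̃-formula-suc-suc : ∀ i j → μ̃-formula p (suc i) (suc j) ≡ μ̃-formula p i j + μ̃-increment i j
  μ̃-formula-suc-suc 0 0 = identity P
    where
    identity : ∀ P → + 2 - P ≡ 1ℤ + (1ℤ - P)
    identity = solve-∀
  μ̃-formula-suc-suc 0 1 = identity P
    where
    identity : ∀ P → P - 1ℤ ≡ - 1ℤ + P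
    identity = solve-∀
  μ̃-formula-suc-suc 0 (suc (suc j)) = refl
  μ̃-formula-suc-suc 1 0 = identity P
    where
    identity : ∀ P → P - 1ℤ ≡ - 1ℤ + P
    identity = solve-∀
  μ̃-formula-suc-suc 1 1 = trans (cong (_-_ (+ 2)) (ℤ.pos-* 2 p)) (identity P)
    where
    identity : ∀ P → + 2 - + 2 * P ≡ (+ 2 - P) + - P
    identity = solve-∀
  μ̃-formula-suc-suc 1 (suc (suc j))             = sym (ℤ.+-identityʳ _)
  μ̃-formula-suc-suc (suc (suc i)) 0             = refl
  μ̃-formula-suc-suc (suc (suc i)) 1             = sym (ℤ.+-identityʳ _)
  μ̃-formula-suc-suc (suc (suc i)) (suc (suc j)) = sym (ℤ.+-identityʳ _)

  private
    Φ k d : ℕ → ℕ → ℤ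
    Φ = μ̃-formula p
    k = minPower p
    d = μ̃-increment

  μ̃-increment-⊛ : ∀ a b → (d ⊛ k) a b ≡ k (suc a) b + k a (suc b) - k (suc a) (suc b) - δ₀ a b
  μ̃-increment-⊛ 0 0 = trans (⊛-zero-zero d k) (identity P)
    where
    identity : ∀ P → (1ℤ - P) * 1ℤ ≡ 1ℤ + 1ℤ - P * 1ℤ - 1ℤ
    identity = solve-∀
  μ̃-increment-⊛ 0 (suc b) = trans (⊛-zero-suc d k b (λ _ → refl)) (identity P)
    where
    identity : ∀ P → (1ℤ - P) * 1ℤ + P * 1ℤ ≡ P * 1ℤ + 1ℤ - P * 1ℤ - 0ℤ
    identity = solve-∀
  μ̃-increment-⊛ (suc a) 0 = trans (⊛-suc-zero d k a (λ _ → refl)) (identity P (k a 0))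
    where
    identity : ∀ P v → (1ℤ - P) * 1ℤ + P * v ≡ 1ℤ + P * v - P * 1ℤ - 0ℤ
    identity = solve-∀
  μ̃-increment-⊛ (suc a) (suc b) = begin
    (d ⊛ k) (suc a) (suc b)
      ≡⟨ ⊛-suc-suc-sparse d k a b (λ _ → refl) (λ _ → refl) ⟩
    ((1ℤ - P) * k₁₁ + P * k₁₀) + (P * k₀₁ + ((λ i j → d (suc i) (suc j)) ⊛ k) a b)
      ≡⟨ cong (λ t → ((1ℤ - P) * k₁₁ + P * k₁₀) + (P * k₀₁ + t))
              (⊛-atOrigin (λ i j → d (suc i) (suc j)) k a b (λ _ _ → refl) (λ _ → refl)) ⟩
    ((1ℤ - P) * k₁₁ + P * k₁₀) + (P * k₀₁ + - P * k a b)
      ≡⟨ identity P (k a b) k₁₀ k₀₁ ⟩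
    k (suc (suc a)) (suc b) + k (suc a) (suc (suc b)) - k (suc (suc a)) (suc (suc b)) - 0ℤ ∎
    where
    k₁₁ k₁₀ k₀₁ : ℤ
    k₁₁ = k (suc a) (suc b)
    k₁₀ = k (suc a) b
    k₀₁ = k a (suc b)
    identity : ∀ P m u w → ((1ℤ - P) * (P * m) + P * u) + (P * w + - P * m) ≡
                           P * u + P * w - P * (P * m) - 0ℤ
    identity = solve-∀

  μ̃-formula-⊛ : ∀ a b → (Φ ⊛ k) a b ≡ δ₀ a b
  μ̃-formula-⊛ 0       0       = refl
  μ̃-formula-⊛ 0       (suc b) = ⊛-zero-suc Φ k b (λ _ → refl)
  μ̃-formula-⊛ (suc a) 0       =
    trans (⊛-suc-zero Φ k a (λ _ → refl)) (cong (λ m → 1ℤ * 1ℤ + - 1ℤ * P ℤ.^ m) (ℕ.⊓-zeroʳ a))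
  μ̃-formula-⊛ (suc a) (suc b) = begin
    (Φ ⊛ k) (suc a) (suc b)
      ≡⟨ ⊛-suc-suc-sparse Φ k a b (λ _ → refl) (λ _ → refl) ⟩
    (1ℤ * k₁₁ + - 1ℤ * k₁₀) + (- 1ℤ * k₀₁ + ((λ i j → Φ (suc i) (suc j)) ⊛ k) a b)
      ≡⟨ cong (λ t → (1ℤ * k₁₁ + - 1ℤ * k₁₀) + (- 1ℤ * k₀₁ + t)) shifted ⟩
    (1ℤ * k₁₁ + - 1ℤ * k₁₀) + (- 1ℤ * k₀₁ + (δ₀ a b + (k₁₀ + k₀₁ - k₁₁ - δ₀ a b)))
      ≡⟨ identity k₁₁ k₁₀ k₀₁ (δ₀ a b) ⟩
    0ℤ ∎
    where
    k₁₁ k₁₀ k₀₁ : ℤ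
    k₁₁ = k (suc a) (suc b)
    k₁₀ = k (suc a) b
    k₀₁ = k a (suc b)

    shifted : ((λ i j → Φ (suc i) (suc j)) ⊛ k) a b ≡ δ₀ a b + (k₁₀ + k₀₁ - k₁₁ - δ₀ a b)
    shifted = begin
      ((λ i j → Φ (suc i) (suc j)) ⊛ k) a b  ≡⟨ ⊛-cong {k = k} μ̃-formula-suc-suc (λ _ _ → refl) a b ⟩
      ((λ i j → Φ i j + d i j) ⊛ k) a b      ≡⟨ ⊛-distribʳ-+ Φ d k a b ⟩
      (Φ ⊛ k) a b + (d ⊛ k) a b              ≡⟨ cong₂ _+_ (μ̃-formula-⊛ a b) (μ̃-increment-⊛ a b) ⟩
      δ₀ a b + (k₁₀ + k₀₁ - k₁₁ - δ₀ a b)    ∎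

    identity : ∀ x y z u → (1ℤ * x + - 1ℤ * y) + (- 1ℤ * z + (u + (y + z - x - u))) ≡ 0ℤ
    identity = solve-∀

lemma10 : (μ̃ : ArithFun₂) → IsInverseOfGcd μ̃ →
          (p : ℕ) → Prime p → (ν₁ ν₂ : ℕ) →
          μ̃ (p ^ ν₁) (p ^ ν₂) ≡ μ̃-formula p ν₁ ν₂
lemma10 μ̃ μ̃⋆gcd≡δ₂ p pr = ⊛-cancelʳ (atPowers p μ̃) (μ̃-formula p) (minPower p) agree
  where
  instance _ = prime⇒nonZero pr
  agree : ∀ a b → (atPowers p μ̃ ⊛ minPower p) a b ≡ (μ̃-formula p ⊛ minPower p) a b
  agree a b = begin
    (atPowers p μ̃ ⊛ minPower p) a b         ≡⟨ ⊛-cong {u = atPowers p μ̃} (λ _ _ → refl) (atPowers-gcdFun p) a b ⟨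
    (atPowers p μ̃ ⊛ atPowers p gcdFun) a b  ≡⟨ ⋆-atPowers pr μ̃ gcdFun a b ⟨
    (μ̃ ⋆ gcdFun) (p ^ a) (p ^ b)            ≡⟨ μ̃⋆gcd≡δ₂ (p ^ a) (p ^ b) (ℕ.m^n>0 p a) (ℕ.m^n>0 p b) ⟩
    δ₂ (p ^ a) (p ^ b)                      ≡⟨ δ₂-^ (1<p pr) a b ⟩
    δ₀ a b                                  ≡⟨ μ̃-formula-⊛ p a b ⟨
    (μ̃-formula p ⊛ minPower p) a b          ∎
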